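{- Let $k\ge 1$ and let $\mathbf{n}=(n_1,\dots,n_k)\in\mathbb{Z}_{>0}^k$ with $n_1\ge n_2\ge\dots\ge n_k$. Let $E:=\{j\in\{1,\dots,k\}: n_j \text{ is even}\}$, $O:=\{1,\dots,k\}\setminus E$, and define $\mathbf{m}=(m_1,\dots,m_k)$ by $m_j:=\frac{n_j}{2}$ if $j\in E$ and $m_j:=\frac{n_j-1}{2}$ if $j\in O$. If $$\max\{n_j : j\in O\}\le \frac{k-1}{2}\min\{n_j: j\in E\}\quad\text{and}\quad \max\{n_j: j\in E\}\le k\min\{n_j: j\in E\},$$ then $\mathbf{n}\in\mathcal{H}(\mathbf{m})$. In particular, $\mathbf{n}$ is a lonely runner instance.
   Context: For $\mathbf{m}\in\mathbb{R}^k$, let $\mathcal{C}(\mathbf{m}):=\mathbf{m}+\left[\frac{1}{k+1},\frac{k}{k+1}\right]^k$, and let $\mathcal{H}(\mathbf{m})$ be the nonnegative span of $\mathcal{C}(\mathbf{m})$, i.e. $\mathcal{H}(\mathbf{m})=\{\lambda\mathbf{x}:\lambda\ge 0,\ \mathbf{x}\in\mathcal{C}(\mathbf{m})\}$ (a polyhedral cone). A vector $\mathbf{n}\in\mathbb{Z}_{>0}^k$ is a lonely runner instance if there exists a real number $t$ such that for all $1\le j\le k$ the distance of $tn_j$ to the nearest integer is at least $\frac{1}{k+1}$. A condition involving a maximum or minimum over an empty set is understood as vacuously satisfied. -}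

module Defs where

open import Data.Nat as ℕ using (ℕ; suc; _%_)
open import Data.Integer as ℤ using (+_)
open import Data.Fin using (Fin)
open import Data.Product using (Σ; _×_)
open import Data.Rational using (ℚ; _/_; _+_; _-_; _*_; _≤_; _⊓_; floor; 0ℚ; 1ℚ)
open import Relation.Binary.PropositionalEquality using (_≡_)

ℕ→ℚ : ℕ → ℚ
ℕ→ℚ n = (+ n) / 1

distInt : ℚ → ℚ
distInt q = let f = q - ((floor q) / 1) in f ⊓ (1ℚ - f)

Even : ℕ → Set
Even a = a % 2 ≡ 0

Odd : ℕ → Set
Odd a = a % 2 ≡ 1

InCube : (k : ℕ) → (Fin k → ℚ) → (Fin k → ℚ) → Set
InCube k m x = ∀ j → (m j + (+ 1) / suc k ≤ x j) × (x j ≤ m j + (+ k) / suc k)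

InCone : (k : ℕ) → (Fin k → ℚ) → (Fin k → ℚ) → Set
InCone k m y = Σ ℚ λ c → (0ℚ ≤ c) × Σ (Fin k → ℚ) λ x → InCube k m x × (∀ j → y j ≡ c * x j)

LonelyRunnerInstance : (k : ℕ) → (Fin k → ℕ) → Set
LonelyRunnerInstance k n = Σ ℚ λ t → ∀ j → (+ 1) / suc k ≤ distInt (t * ℕ→ℚ (n j))

-- the vector m: m_j = n_j/2 if n_j even, (n_j-1)/2 if odd, i.e. ⌊n_j/2⌋
halfVec : (k : ℕ) → (Fin k → ℕ) → (Fin k → ℚ)
halfVec k n j = ℕ→ℚ (n j ℕ./ 2)

-- At time t = (K d + 2 a) / (2 K d), with K = k + 1, where d is the least even
-- speed and a = 1 (or d = 1 and a = 0 when all speeds are odd), a speed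
-- n = 2 m + e with e ∈ {0, 1} satisfies t n − m = (K d e + 2 a n) / (2 K d).
-- The hypotheses say exactly that this lies in [1/K, k/K]: for even n it is
-- n / (K d), and d ≤ n ≤ k d; for odd n it is 1/2 + n / (K d) ≤ k/K, i.e.
-- 2 n ≤ (k − 1) d.  So t n ∈ C(m), whence n = t⁻¹ (t n) ∈ H(m), and as m is
-- integral every runner is at distance at least 1/K from ℤ at time t.
module Submission where

open import Defs
open import Data.Nat using (ℕ; _≤_; _<_; _*_; _∸_)
open import Data.Fin using (Fin) renaming (_≤_ to _≤ᶠ_)
open import Data.Product using (_×_)

import Data.Fin as Fin
open import Data.Nat as ℕ using (zero; suc; _+_; NonZero; z≤n; s≤s)
import Data.Nat.Properties as ℕₚ
open import Data.Nat.DivMod using (m≡m%n+[m/n]*n; m%n<n; m<n*o⇒m/o<n; /-monoˡ-≤; m*n/n≡m)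
open import Data.Nat.Tactic.RingSolver using (solve)
open import Data.Integer as ℤ using (+_; -[1+_])
import Data.Integer.Properties as ℤₚ
open import Data.Rational as ℚ using (ℚ; mkℚ; _/_; toℚᵘ; floor; 1ℚ)
import Data.Rational.Properties as ℚₚ
open import Data.Rational.Unnormalised as ℚᵘ using (mkℚᵘ; *≡*; *≤*; *<*)
import Data.Rational.Unnormalised.Properties as ℚᵘₚ
open import Data.Rational.Solver using (module +-*-Solver)
open +-*-Solver using (_:+_; _:-_; _:=_) renaming (solve to solveℚ)
open import Data.Empty using (⊥-elim)
open import Data.List using ([]; _∷_)
open import Data.Product using (Σ; ∃-syntax; _,_; proj₁; proj₂)
open import Data.Sum using (_⊎_; inj₁; inj₂)
open import Function using (_∘_)
open import Relation.Binary.PropositionalEquality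
open import Relation.Nullary using (¬_; Dec; yes; no)
open import Relation.Unary using (Decidable)

-- p ≐ a ÷ B : the rational p is the fraction a / B, kept unreduced so that
-- sums, products and comparisons become identities and inequalities in ℕ.
infix 4 _≐_÷_

_≐_÷_ : ℚ → ℕ → ℕ → Set
p ≐ a ÷ B = Σ ℕ λ b → suc b ≡ B × toℚᵘ p ℚᵘ.≃ mkℚᵘ (+ a) b

/-≐ : ∀ a B .{{_ : NonZero B}} → (+ a) / B ≐ a ÷ B
/-≐ a (suc b) = b , refl , ℚₚ.toℚᵘ-fromℚᵘ (mkℚᵘ (+ a) b)

module _ {p q : ℚ} {a B c D : ℕ} where

  +-≐ : p ≐ a ÷ B → q ≐ c ÷ D → p ℚ.+ q ≐ a * D + c * B ÷ B * D
  +-≐ (b , refl , p≃) (d , refl , q≃) = _ , refl ,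
    ℚᵘₚ.≃-trans (ℚₚ.toℚᵘ-homo-+ p q) (ℚᵘₚ.≃-trans (ℚᵘₚ.+-cong p≃ q≃)
      (ℚᵘₚ.≃-reflexive (cong (λ z → mkℚᵘ z _) (sym (begin
        + (a * suc d + c * suc b)           ≡⟨ ℤₚ.pos-+ (a * suc d) (c * suc b) ⟩
        + (a * suc d) ℤ.+ + (c * suc b)     ≡⟨ cong₂ ℤ._+_ (ℤₚ.pos-* a (suc d))
                                                                 (ℤₚ.pos-* c (suc b)) ⟩
        + a ℤ.* + suc d ℤ.+ + c ℤ.* + suc b ∎)))))
    where open ≡-Reasoning

  *-≐ : p ≐ a ÷ B → q ≐ c ÷ D → p ℚ.* q ≐ a * c ÷ B * D
  *-≐ (b , refl , p≃) (d , refl , q≃) = _ , refl ,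
    ℚᵘₚ.≃-trans (ℚₚ.toℚᵘ-homo-* p q) (ℚᵘₚ.≃-trans (ℚᵘₚ.*-cong p≃ q≃)
      (ℚᵘₚ.≃-reflexive (cong (λ z → mkℚᵘ z _) (sym (ℤₚ.pos-* a c)))))

  cross-≡⇒≡ : p ≐ a ÷ B → q ≐ c ÷ D → a * D ≡ c * B → p ≡ q
  cross-≡⇒≡ (b , refl , p≃) (d , refl , q≃) eq = ℚₚ.toℚᵘ-injective
    (ℚᵘₚ.≃-trans p≃ (ℚᵘₚ.≃-trans
      (*≡* (trans (sym (ℤₚ.pos-* a (suc d))) (trans (cong +_ eq) (ℤₚ.pos-* c (suc b)))))
      (ℚᵘₚ.≃-sym q≃)))

  cross-≤⇒≤ : p ≐ a ÷ B → q ≐ c ÷ D → a * D ≤ c * B → p ℚ.≤ q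
  cross-≤⇒≤ (b , refl , p≃) (d , refl , q≃) le = ℚₚ.toℚᵘ-cancel-≤
    (ℚᵘₚ.≤-respˡ-≃ (ℚᵘₚ.≃-sym p≃) (ℚᵘₚ.≤-respʳ-≃ (ℚᵘₚ.≃-sym q≃)
      (*≤* (subst₂ ℤ._≤_ (ℤₚ.pos-* a (suc d)) (ℤₚ.pos-* c (suc b)) (ℤ.+≤+ le)))))

  ≤⇒cross-≤ : p ≐ a ÷ B → q ≐ c ÷ D → p ℚ.≤ q → a * D ≤ c * B
  ≤⇒cross-≤ (b , refl , p≃) (d , refl , q≃) le
    with ℚᵘₚ.≤-respˡ-≃ p≃ (ℚᵘₚ.≤-respʳ-≃ q≃ (ℚₚ.toℚᵘ-mono-≤ le))
  ... | *≤* le′ =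
    ℤₚ.drop‿+≤+ (subst₂ ℤ._≤_ (sym (ℤₚ.pos-* a (suc d))) (sym (ℤₚ.pos-* c (suc b))) le′)

  cross-<⇒< : p ≐ a ÷ B → q ≐ c ÷ D → a * D < c * B → p ℚ.< q
  cross-<⇒< (b , refl , p≃) (d , refl , q≃) lt = ℚₚ.toℚᵘ-cancel-<
    (ℚᵘₚ.<-respˡ-≃ (ℚᵘₚ.≃-sym p≃) (ℚᵘₚ.<-respʳ-≃ (ℚᵘₚ.≃-sym q≃)
      (*<* (subst₂ ℤ._<_ (ℤₚ.pos-* a (suc d)) (ℤₚ.pos-* c (suc b)) (ℤ.+<+ lt)))))

  <⇒cross-< : p ≐ a ÷ B → q ≐ c ÷ D → p ℚ.< q → a * D < c * B
  <⇒cross-< (b , refl , p≃) (d , refl , q≃) lt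
    with ℚᵘₚ.<-respˡ-≃ p≃ (ℚᵘₚ.<-respʳ-≃ q≃ (ℚₚ.toℚᵘ-mono-< lt))
  ... | *<* lt′ =
    ℤₚ.drop‿+<+ (subst₂ ℤ._<_ (sym (ℤₚ.pos-* a (suc d))) (sym (ℤₚ.pos-* c (suc b))) lt′)

n*o≤m<[1+n]*o⇒m/o≡n : ∀ {m n o} .{{_ : NonZero o}} →
  n * o ≤ m → m < suc n * o → m ℕ./ o ≡ n
n*o≤m<[1+n]*o⇒m/o≡n {m} {n} {o} lo hi = ℕₚ.≤-antisym
  (ℕₚ.<⇒≤pred (m<n*o⇒m/o<n hi))
  (subst (_≤ m ℕ./ o) (m*n/n≡m n o) (/-monoˡ-≤ o lo))

floor-unique : ∀ h q → ℕ→ℚ h ℚ.≤ q → q ℚ.< ℕ→ℚ (suc h) → floor q ≡ + h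
floor-unique h q@(mkℚ -[1+ _ ] _ _) h≤q _ =
  ⊥-elim (ℚₚ.<-irrefl refl (ℚₚ.<-≤-trans (ℚₚ.negative⁻¹ q)
    (ℚₚ.≤-trans (cross-≤⇒≤ (/-≐ 0 1) (/-≐ h 1) z≤n) h≤q)))
-- For a positive divisor, ℤ division unfolds to 1ℤ * + (a / suc d).
floor-unique h q@(mkℚ (+ a) d _) h≤q q<h+1 =
  trans (ℤₚ.*-identityˡ (+ (a ℕ./ suc d))) (cong +_ (n*o≤m<[1+n]*o⇒m/o≡n
    (subst (h * suc d ≤_) (ℕₚ.*-identityʳ a) (≤⇒cross-≤ (/-≐ h 1) q≐ h≤q))
    (subst (_< suc h * suc d) (ℕₚ.*-identityʳ a) (<⇒cross-< q≐ (/-≐ (suc h) 1) q<h+1))))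
  where
  q≐ : q ≐ a ÷ suc d
  q≐ = d , refl , ℚᵘₚ.≃-refl

p+q≤r⇒q≤r-p : ∀ {p q r} → p ℚ.+ q ℚ.≤ r → q ℚ.≤ r ℚ.- p
p+q≤r⇒q≤r-p {p} {q} {r} le =
  subst (ℚ._≤ r ℚ.- p) (solveℚ 2 (λ p q → (p :+ q) :- p := q) refl p q)
    (ℚₚ.+-monoˡ-≤ (ℚ.- p) le)

distInt-≥ : ∀ k h q → ℕ→ℚ h ℚ.+ (+ 1) / suc k ℚ.≤ q → q ℚ.≤ ℕ→ℚ h ℚ.+ (+ k) / suc k →
  (+ 1) / suc k ℚ.≤ distInt q
distInt-≥ k h q h+ε≤q q≤h+δ =
  subst (ε ℚ.≤_) (cong (λ z → let f = q ℚ.- z / 1 in f ℚ.⊓ (1ℚ ℚ.- f)) (sym ⌊q⌋≡h))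
    (ℚₚ.⊓-glb (p+q≤r⇒q≤r-p h+ε≤q) (p+q≤r⇒q≤r-p {q ℚ.- ℕ→ℚ h} frac+ε≤1))
  where
  ε δ : ℚ
  ε = (+ 1) / suc k
  δ = (+ k) / suc k
  h≐ : ℕ→ℚ h ≐ h ÷ 1
  h≐ = /-≐ h 1
  ε≐ : ε ≐ 1 ÷ suc k
  ε≐ = /-≐ 1 (suc k)
  δ≐ : δ ≐ k ÷ suc k
  δ≐ = /-≐ k (suc k)

  ⌊q⌋≡h : floor q ≡ + h
  ⌊q⌋≡h = floor-unique h q
    (ℚₚ.≤-trans (cross-≤⇒≤ h≐ (+-≐ h≐ ε≐) (begin
        h * (1 * suc k)         ≡⟨ solve (h ∷ k ∷ []) ⟩
        h * suc k               ≤⟨ ℕₚ.m≤m+n (h * suc k) 1 ⟩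
        h * suc k + 1           ≡⟨ solve (h ∷ k ∷ []) ⟩
        (h * suc k + 1 * 1) * 1 ∎)) h+ε≤q)
    (ℚₚ.≤-<-trans q≤h+δ (cross-<⇒< (+-≐ h≐ δ≐) (/-≐ (suc h) 1) (begin-strict
        (h * suc k + k * 1) * 1 ≡⟨ solve (h ∷ k ∷ []) ⟩
        h * suc k + k           <⟨ ℕₚ.n<1+n (h * suc k + k) ⟩
        suc (h * suc k + k)     ≡⟨ solve (h ∷ k ∷ []) ⟩
        suc h * (1 * suc k)     ∎)))
    where open ℕₚ.≤-Reasoning

  δ+ε≡1 : δ ℚ.+ ε ≡ 1ℚ
  δ+ε≡1 = cross-≡⇒≡ (+-≐ δ≐ ε≐) (/-≐ 1 1) (solve (k ∷ []))

  frac+ε≤1 : (q ℚ.- ℕ→ℚ h) ℚ.+ ε ℚ.≤ 1ℚ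
  frac+ε≤1 = subst ((q ℚ.- ℕ→ℚ h) ℚ.+ ε ℚ.≤_)
    (trans (solveℚ 3 (λ h δ ε → ((h :+ δ) :- h) :+ ε := δ :+ ε) refl (ℕ→ℚ h) δ ε) δ+ε≡1)
    (ℚₚ.+-monoˡ-≤ ε (ℚₚ.+-monoˡ-≤ (ℚ.- ℕ→ℚ h) q≤h+δ))

cube⇒lonelyRunner : ∀ k (n h : Fin k → ℕ) t →
  InCube k (λ j → ℕ→ℚ (h j)) (λ j → t ℚ.* ℕ→ℚ (n j)) → LonelyRunnerInstance k n
cube⇒lonelyRunner k n h t tn∈C =
  t , λ j → distInt-≥ k (h j) _ (proj₁ (tn∈C j)) (proj₂ (tn∈C j))

scaledCube⇒inCone : ∀ k m (n : Fin k → ℕ) {t L D} .{{_ : NonZero L}} → t ≐ L ÷ D →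
  InCube k m (λ j → t ℚ.* ℕ→ℚ (n j)) → InCone k m (λ j → ℕ→ℚ (n j))
scaledCube⇒inCone k m n {t} {L} {D} t≐ tn∈C =
  c , cross-≤⇒≤ (/-≐ 0 1) c≐ z≤n , (λ j → t ℚ.* ℕ→ℚ (n j)) , tn∈C , λ j → x≡c*tx (n j)
  where
  c : ℚ
  c = (+ D) / L
  c≐ : c ≐ D ÷ L
  c≐ = /-≐ D L
  x≡c*tx : ∀ x → ℕ→ℚ x ≡ c ℚ.* (t ℚ.* ℕ→ℚ x)
  x≡c*tx x = cross-≡⇒≡ (/-≐ x 1) (*-≐ c≐ (*-≐ t≐ (/-≐ x 1))) (solve (x ∷ L ∷ D ∷ []))

time : (k d a : ℕ) .{{_ : NonZero d}} → ℚ
time k d@(suc _) a = (+ (suc k * d + 2 * a)) / (2 * (suc k * d))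

time-≐ : ∀ k d a .{{_ : NonZero d}} → time k d a ≐ suc k * d + 2 * a ÷ 2 * (suc k * d)
time-≐ k d@(suc _) a = /-≐ _ _

offset : (k d a n : ℕ) → ℕ
offset k d a n = suc k * d * (n ℕ.% 2) + 2 * a * n

record OffsetBounded (k d a n : ℕ) : Set where
  constructor _,_
  field
    lower : 2 * d ≤ offset k d a n
    upper : offset k d a n ≤ 2 * k * d

time-in-cube : ∀ k d a n .{{_ : NonZero d}} → OffsetBounded k d a n →
  ℕ→ℚ (n ℕ./ 2) ℚ.+ (+ 1) / suc k ℚ.≤ time k d a ℚ.* ℕ→ℚ n
  × time k d a ℚ.* ℕ→ℚ n ℚ.≤ ℕ→ℚ (n ℕ./ 2) ℚ.+ (+ k) / suc k
time-in-cube k d a n (lo , hi) = bounds (n ℕ./ 2) (n ℕ.% 2) (m≡m%n+[m/n]*n n 2) lo hi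
  where
  open ℕₚ.≤-Reasoning
  bounds : ∀ m e {x} → x ≡ e + m * 2 →
    2 * d ≤ suc k * d * e + 2 * a * x → suc k * d * e + 2 * a * x ≤ 2 * k * d →
    ℕ→ℚ m ℚ.+ (+ 1) / suc k ℚ.≤ time k d a ℚ.* ℕ→ℚ x
    × time k d a ℚ.* ℕ→ℚ x ℚ.≤ ℕ→ℚ m ℚ.+ (+ k) / suc k
  bounds m e refl lo hi =
      cross-≤⇒≤ (+-≐ (/-≐ m 1) (/-≐ 1 (suc k))) tx≐ (begin
        (m * suc k + 1 * 1) * (2 * (suc k * d) * 1)
          ≡⟨ solve (k ∷ d ∷ m ∷ []) ⟩
        suc k * (2 * suc k * d * m + 2 * d)
          ≤⟨ shift lo ⟩
        suc k * (2 * suc k * d * m + (suc k * d * e + 2 * a * (e + m * 2)))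
          ≡⟨ solve (k ∷ d ∷ a ∷ m ∷ e ∷ []) ⟩
        (suc k * d + 2 * a) * (e + m * 2) * (1 * suc k) ∎)
    , cross-≤⇒≤ tx≐ (+-≐ (/-≐ m 1) (/-≐ k (suc k))) (begin
        (suc k * d + 2 * a) * (e + m * 2) * (1 * suc k)
          ≡⟨ solve (k ∷ d ∷ a ∷ m ∷ e ∷ []) ⟩
        suc k * (2 * suc k * d * m + (suc k * d * e + 2 * a * (e + m * 2)))
          ≤⟨ shift hi ⟩
        suc k * (2 * suc k * d * m + 2 * k * d)
          ≡⟨ solve (k ∷ d ∷ m ∷ []) ⟩
        (m * suc k + k * 1) * (2 * (suc k * d) * 1) ∎)
    where
    tx≐ : time k d a ℚ.* ℕ→ℚ (e + m * 2) ≐ (suc k * d + 2 * a) * (e + m * 2) ÷ 2 * (suc k * d) * 1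
    tx≐ = *-≐ (time-≐ k d a) (/-≐ (e + m * 2) 1)
    shift : ∀ {u v} → u ≤ v → suc k * (2 * suc k * d * m + u) ≤ suc k * (2 * suc k * d * m + v)
    shift u≤v = ℕₚ.*-monoʳ-≤ (suc k) (ℕₚ.+-monoʳ-≤ (2 * suc k * d * m) u≤v)

even-offset : ∀ {k d n} → Even n → d ≤ n → n ≤ k * d → OffsetBounded k d 1 n
even-offset {k} {d} {n} ev d≤n n≤kd =
  (begin 2 * d ≤⟨ ℕₚ.*-monoʳ-≤ 2 d≤n ⟩ 2 * n ≡⟨ sym r≡2n ⟩ offset k d 1 n ∎) ,
  (begin
    offset k d 1 n ≡⟨ r≡2n ⟩
    2 * n          ≤⟨ ℕₚ.*-monoʳ-≤ 2 n≤kd ⟩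
    2 * (k * d)    ≡⟨ solve (k ∷ d ∷ []) ⟩
    2 * k * d      ∎)
  where
  open ℕₚ.≤-Reasoning
  r≡2n : offset k d 1 n ≡ 2 * n
  r≡2n = trans (cong (λ e → suc k * d * e + 2 * 1 * n) ev) (solve (k ∷ d ∷ n ∷ []))

odd-offset : ∀ {k d a n} → Odd n → 2 * a * n ≤ k * d → OffsetBounded (suc k) d a n
odd-offset {k} {d} {a} {n} od 2an≤kd =
  (begin
    2 * d                         ≤⟨ ℕₚ.*-monoˡ-≤ d {2} {suc (suc k)} (s≤s (s≤s z≤n)) ⟩
    suc (suc k) * d               ≤⟨ ℕₚ.m≤m+n (suc (suc k) * d) (2 * a * n) ⟩
    suc (suc k) * d + 2 * a * n   ≡⟨ sym r≡ ⟩
    offset (suc k) d a n          ∎) ,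
  (begin
    offset (suc k) d a n          ≡⟨ r≡ ⟩
    suc (suc k) * d + 2 * a * n   ≤⟨ ℕₚ.+-monoʳ-≤ (suc (suc k) * d) 2an≤kd ⟩
    suc (suc k) * d + k * d       ≡⟨ solve (k ∷ d ∷ []) ⟩
    2 * suc k * d                 ∎)
  where
  open ℕₚ.≤-Reasoning
  r≡ : offset (suc k) d a n ≡ suc (suc k) * d + 2 * a * n
  r≡ = trans (cong (λ e → suc (suc k) * d * e + 2 * a * n) od) (solve (k ∷ d ∷ a ∷ n ∷ []))

even? : ∀ n → Dec (Even n)
even? n = n ℕ.% 2 ℕ.≟ 0

¬even⇒odd : ∀ n → ¬ Even n → Odd n
¬even⇒odd n ¬ev with n ℕ.% 2 | m%n<n n 2
... | 0           | _             = ⊥-elim (¬ev refl)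
... | 1           | _             = refl
... | suc (suc _) | s≤s (s≤s ())

none⊎argmin : ∀ {k p} {P : Fin k → Set p} → Decidable P → (f : Fin k → ℕ) →
  (∀ j → ¬ P j) ⊎ ∃[ j ] P j × (∀ i → P i → f j ≤ f i)
none⊎argmin {zero} P? f = inj₁ λ ()
none⊎argmin {suc k} P? f with none⊎argmin (P? ∘ Fin.suc) (f ∘ Fin.suc) | P? Fin.zero
... | inj₁ ¬P | no ¬P₀ = inj₁ λ { Fin.zero → ¬P₀ ; (Fin.suc j) → ¬P j }
... | inj₁ ¬P | yes P₀ = inj₂ (Fin.zero , P₀ , λ
  { Fin.zero    _  → ℕₚ.≤-refl
  ; (Fin.suc i) Pi → ⊥-elim (¬P i Pi) })
... | inj₂ (j , Pj , min) | no ¬P₀ = inj₂ (Fin.suc j , Pj , λ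
  { Fin.zero    P₀ → ⊥-elim (¬P₀ P₀)
  ; (Fin.suc i) Pi → min i Pi })
... | inj₂ (j , Pj , min) | yes P₀ with f Fin.zero ℕ.≤? f (Fin.suc j)
...   | yes f₀≤ = inj₂ (Fin.zero , P₀ , λ
  { Fin.zero    _  → ℕₚ.≤-refl
  ; (Fin.suc i) Pi → ℕₚ.≤-trans f₀≤ (min i Pi) })
...   | no f₀≰ = inj₂ (Fin.suc j , Pj , λ
  { Fin.zero    _  → ℕₚ.<⇒≤ (ℕₚ.≰⇒> f₀≰)
  ; (Fin.suc i) Pi → min i Pi })

offsets⇒inCone×lonelyRunner : ∀ k (n : Fin k → ℕ) d a .{{_ : NonZero d}} →
  (∀ j → OffsetBounded k d a (n j)) →
  InCone k (halfVec k n) (λ j → ℕ→ℚ (n j)) × LonelyRunnerInstance k n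
offsets⇒inCone×lonelyRunner k n d@(suc _) a bounded =
  scaledCube⇒inCone k (halfVec k n) n (time-≐ k d a) tn∈C ,
  cube⇒lonelyRunner k n (λ j → n j ℕ./ 2) (time k d a) tn∈C
  where
  tn∈C : InCube k (halfVec k n) (λ j → time k d a ℚ.* ℕ→ℚ (n j))
  tn∈C j = time-in-cube k d a (n j) (bounded j)

theorem5 : (k : ℕ) → 1 ≤ k → (n : Fin k → ℕ)
    → (∀ j → 0 < n j)
    → (∀ i j → i ≤ᶠ j → n j ≤ n i)
    → (∀ i j → Odd (n i) → Even (n j) → 2 * n i ≤ (k ∸ 1) * n j)
    → (∀ i j → Even (n i) → Even (n j) → n i ≤ k * n j)
    → InCone k (halfVec k n) (λ j → ℕ→ℚ (n j)) × LonelyRunnerInstance k n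
theorem5 (suc k) _ n pos _ odd≤even even≤even with none⊎argmin (even? ∘ n) n
... | inj₁ allOdd =
  offsets⇒inCone×lonelyRunner (suc k) n 1 0 λ j → odd-offset (¬even⇒odd (n j) (allOdd j)) z≤n
... | inj₂ (j₀ , ev₀ , min) =
  offsets⇒inCone×lonelyRunner (suc k) n (n j₀) 1 {{ℕ.>-nonZero (pos j₀)}} bounded
  where
  bounded : ∀ j → OffsetBounded (suc k) (n j₀) 1 (n j)
  bounded j with even? (n j)
  ... | yes ev  = even-offset ev (min j ev) (even≤even j j₀ ev ev₀)
  ... | no ¬ev  = let od = ¬even⇒odd (n j) ¬ev in odd-offset od (odd≤even j j₀ od ev₀)
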